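{- Let $n\ge 1$ and let $F_n$ be the $n\times n$ tridiagonal matrix with all diagonal entries equal to $1$, all superdiagonal entries equal to $1$, all subdiagonal entries equal to $-1$, and all other entries $0$. For $k=0,1,\ldots,n-1$, let $S_{n-k}$ denote the sum of all principal minors of order $n-k$ of $F_n$. Then \[S_{n-k}=\sum_{j_1+j_2+\cdots+j_{k+1}=n-k}f_{j_1+1}f_{j_2+1}\cdots f_{j_{k+1}+1},\] where the sum is over all $(k+1)$-tuples of integers $j_t\ge 0$ $(t=1,\ldots,k+1)$ with $j_1+\cdots+j_{k+1}=n-k$.
   Context: Fibonacci numbers are $f_{ -1}=1$, $f_0=0$, $f_1=1$, $f_{m+1}=f_m+f_{m-1}$. A principal minor of order $n-k$ is the determinant of the submatrix obtained by deleting $k$ rows and the columns with the same indices. The right-hand side is called the convolved Fibonacci number $f^{(k+1)}_{n-k+1}$. -}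

module Defs where

open import Data.Nat as ℕ using (ℕ; zero; suc)
open import Data.Fin using (Fin; zero; suc; punchIn; toℕ)
open import Data.Integer using (ℤ; +_; -_; _+_; _*_; 0ℤ; 1ℤ)
open import Data.List using (List; []; _∷_; map; _++_; length; concatMap; filterᵇ; foldr)
import Data.List as L
open import Data.Vec using (Vec; []; _∷_)
import Data.Vec as V
open import Relation.Nullary using (yes; no)
open import Data.Bool using (Bool; true; false)

fib : ℕ → ℕ
fib 0 = 0
fib 1 = 1
fib (suc (suc m)) = fib (suc m) ℕ.+ fib m

Matrix : ℕ → Set
Matrix n = Fin n → Fin n → ℤ

Σᶠ : ∀ {n} → (Fin n → ℤ) → ℤ
Σᶠ {zero}  f = 0ℤ
Σᶠ {suc n} f = f zero + Σᶠ (λ i → f (suc i))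

sign : ℕ → ℤ
sign zero = 1ℤ
sign (suc k) = - sign k

det : ∀ {n} → Matrix n → ℤ
det {zero}  M = 1ℤ
det {suc n} M = Σᶠ (λ j → sign (toℕ j) * (M zero j * det (λ r c → M (suc r) (punchIn j c))))

F : (n : ℕ) → Matrix n
F n i j with toℕ i ℕ.≟ toℕ j | suc (toℕ i) ℕ.≟ toℕ j | toℕ i ℕ.≟ suc (toℕ j)
... | yes _ | _ | _ = 1ℤ
... | no _ | yes _ | _ = 1ℤ
... | no _ | no _ | yes _ = - 1ℤ
... | no _ | no _ | no _ = 0ℤ

-- All subsets of {0,…,n-1}, each as the increasing list of its elements.
subsets : (n : ℕ) → List (List (Fin n))
subsets zero = [] ∷ []
subsets (suc n) = map (map suc) (subsets n) ++ map (λ s → zero ∷ map suc s) (subsets n)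

principalSub : ∀ {n} → Matrix n → (s : List (Fin n)) → Matrix (length s)
principalSub M s i j = M (L.lookup s i) (L.lookup s j)

sumPrincipalMinors : ∀ {n} → Matrix n → ℕ → ℤ
sumPrincipalMinors {n} M m =
  foldr (λ s acc → det (principalSub M s) + acc) 0ℤ
        (filterᵇ (λ s → length s ℕ.≡ᵇ m) (subsets n))

boxTuples : (r b : ℕ) → List (Vec ℕ r)
boxTuples zero b = [] ∷ []
boxTuples (suc r) b = concatMap (λ x → map (x ∷_) (boxTuples r b)) (L.upTo (suc b))

compositions : (r m : ℕ) → List (Vec ℕ r)
compositions r m = filterᵇ (λ v → V.sum v ℕ.≡ᵇ m) (boxTuples r m)

convFib : (r m : ℕ) → ℕ
convFib r m = foldr ℕ._+_ 0 (map (λ v → V.foldr _ ℕ._*_ 1 (V.map (λ j → fib (suc j)) v)) (compositions r m))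

-- On an increasing index list the principal submatrix of F_n is again tridiagonal, and the
-- product of its sub- and superdiagonal entries is -1 between consecutive indices and 0
-- otherwise, so its determinant obeys the continuant recurrence D(a b r) = D(b r) + [b = a+1] D(r).
-- Splitting the subsets of {0,…,n} by whether they contain 0 (and then 1) gives, for the sum
-- S(n, m) of the principal minors of order m,
--   S(n+1, m+1) = S(n, m+1) + S(n, m) + S(n-1, m-1),
-- the last term being absent when n = 0 or m = 0.  The (k+1)-fold convolution power C(k+1, m)
-- of (f_{j+1}) obeys C(k+1, m+2) = C(k, m+2) + C(k+1, m+1) + C(k+1, m) since
-- f_{j+3} = f_{j+2} + f_{j+1}, so S(m+k, m) = C(k+1, m) by induction on m and k, starting from
-- S(n, 0) = 1, S(n, 1) = n and S(n, m) = 0 for n < m.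
module Submission where

open import Level using (0ℓ)
open import Algebra.Bundles using (CommutativeSemiring)
import Algebra.Properties.CommutativeSemigroup
open import Data.Bool using (Bool; true; false; if_then_else_)
open import Data.Fin as Fin using (Fin; zero; suc; toℕ)
open import Data.Integer as ℤ using (ℤ; +_; -_; _-_; 0ℤ; 1ℤ)
import Data.Integer.Properties as ℤ
import Data.Integer.Tactic.RingSolver as ℤ-Solver
open import Data.List using (List; []; _∷_; map; length; _++_; filterᵇ; foldr; concatMap; upTo; lookup)
open import Data.List.Properties using (length-map; map-∘; map-applyUpTo)
open import Data.List.Membership.Propositional.Properties using (∈-lookup)
open import Data.List.Relation.Unary.All as All using (All; []; _∷_)
import Data.List.Relation.Unary.All.Properties as All
open import Data.List.Relation.Unary.AllPairs as AllPairs using (AllPairs; []; _∷_)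
import Data.List.Relation.Unary.AllPairs.Properties as AllPairs
open import Data.Nat as ℕ using (ℕ; zero; suc; _+_; _*_; _≤_; _<_; s≤s; z≤n; z<s; _≡ᵇ_; _∸_)
import Data.Nat.Properties as ℕ
import Data.Nat.Tactic.RingSolver as ℕ-Solver
open import Data.Vec as Vec using (Vec)
open import Function using (id; _∘_; _on_)
open import Relation.Binary.Bundles using (Setoid)
open import Relation.Binary.PropositionalEquality
open import Relation.Nullary using (yes; no; contradiction)

open import Defs

-- Determinants

Σᶠ-cong : ∀ {n} {f g : Fin n → ℤ} → (∀ i → f i ≡ g i) → Σᶠ f ≡ Σᶠ g
Σᶠ-cong {zero}  e = refl
Σᶠ-cong {suc n} e = cong₂ ℤ._+_ (e zero) (Σᶠ-cong (e ∘ suc))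

Σᶠ-zero : ∀ {n} {f : Fin n → ℤ} → (∀ i → f i ≡ 0ℤ) → Σᶠ f ≡ 0ℤ
Σᶠ-zero {zero}  e = refl
Σᶠ-zero {suc n} e = cong₂ ℤ._+_ (e zero) (Σᶠ-zero (e ∘ suc))

minor : ∀ {n} → Matrix (suc n) → Fin (suc n) → Matrix n
minor M j r c = M (suc r) (Fin.punchIn j c)

det-cong : ∀ {n} {M N : Matrix n} → (∀ i j → M i j ≡ N i j) → det M ≡ det N
det-cong {zero}  e = refl
det-cong {suc n} e = Σᶠ-cong λ j →
  cong₂ (λ x d → sign (toℕ j) ℤ.* (x ℤ.* d)) (e zero j) (det-cong (λ r c → e (suc r) (Fin.punchIn j c)))

cofactorTerm-zeroˡ : ∀ s {a} d → a ≡ 0ℤ → s ℤ.* (a ℤ.* d) ≡ 0ℤ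
cofactorTerm-zeroˡ s d refl = ℤ.*-zeroʳ s

cofactorTerm-zeroʳ : ∀ s a {d} → d ≡ 0ℤ → s ℤ.* (a ℤ.* d) ≡ 0ℤ
cofactorTerm-zeroʳ s a refl = trans (cong (s ℤ.*_) (ℤ.*-zeroʳ a)) (ℤ.*-zeroʳ s)

det-firstColumn-zero : ∀ {n} (M : Matrix (suc n)) → (∀ r → M r zero ≡ 0ℤ) → det M ≡ 0ℤ
det-firstColumn-zero {zero}  M e = cong (ℤ._+ 0ℤ) (cofactorTerm-zeroˡ 1ℤ 1ℤ (e zero))
det-firstColumn-zero {suc n} M e = Σᶠ-zero term
  where
  term : ∀ j → sign (toℕ j) ℤ.* (M zero j ℤ.* det (minor M j)) ≡ 0ℤ
  term zero    = cofactorTerm-zeroˡ 1ℤ (det (minor M zero)) (e zero)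
  term (suc i) = cofactorTerm-zeroʳ (sign (toℕ (suc i))) (M zero (suc i))
                   (det-firstColumn-zero (minor M (suc i)) (e ∘ suc))

det-firstColumn-pivot : ∀ {n} (M : Matrix (suc n)) → (∀ r → M (suc r) zero ≡ 0ℤ) →
  det M ≡ M zero zero ℤ.* det (minor M zero)
det-firstColumn-pivot {n} M e = begin
  det M                ≡⟨ cong₂ ℤ._+_ (ℤ.*-identityˡ pivotTerm) (rest-zero n M e) ⟩
  pivotTerm ℤ.+ 0ℤ     ≡⟨ ℤ.+-identityʳ pivotTerm ⟩
  pivotTerm            ∎
  where
  open ≡-Reasoning
  pivotTerm : ℤ
  pivotTerm = M zero zero ℤ.* det (minor M zero)
  rest-zero : ∀ n (M : Matrix (suc n)) → (∀ r → M (suc r) zero ≡ 0ℤ) →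
    Σᶠ (λ i → sign (toℕ (suc i)) ℤ.* (M zero (suc i) ℤ.* det (minor M (suc i)))) ≡ 0ℤ
  rest-zero zero    M e = refl
  rest-zero (suc n) M e = Σᶠ-zero λ i →
    cofactorTerm-zeroʳ (sign (toℕ (suc i))) (M zero (suc i)) (det-firstColumn-zero (minor M (suc i)) e)

-- Expanding along the first row leaves two cofactors; the second one has a single
-- nonzero entry in its first column.
det-tridiagonalStep : ∀ {n} (M : Matrix (suc (suc n))) →
  (∀ c → M zero (suc (suc c)) ≡ 0ℤ) → (∀ r → M (suc (suc r)) zero ≡ 0ℤ) →
  det M ≡ M zero zero ℤ.* det (minor M zero)
        - M zero (suc zero) ℤ.* M (suc zero) zero ℤ.* det (λ r c → M (suc (suc r)) (suc (suc c)))
det-tridiagonalStep M row col = begin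
  det M
    ≡⟨ cong₂ (λ d z → 1ℤ ℤ.* (a ℤ.* d₁) ℤ.+ (- 1ℤ ℤ.* (b ℤ.* d) ℤ.+ z))
             (det-firstColumn-pivot (minor M (suc zero)) col)
             (Σᶠ-zero λ i → cofactorTerm-zeroˡ (sign (toℕ (suc (suc i)))) (det (minor M (suc (suc i))))
                                                (row i)) ⟩
  1ℤ ℤ.* (a ℤ.* d₁) ℤ.+ (- 1ℤ ℤ.* (b ℤ.* (c ℤ.* d₂)) ℤ.+ 0ℤ)
    ≡⟨ expand a b c d₁ d₂ ⟩
  a ℤ.* d₁ - b ℤ.* c ℤ.* d₂ ∎
  where
  open ≡-Reasoning
  a b c d₁ d₂ : ℤ
  a = M zero zero
  b = M zero (suc zero)
  c = M (suc zero) zero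
  d₁ = det (minor M zero)
  d₂ = det (λ r c → M (suc (suc r)) (suc (suc c)))
  expand : ∀ a b c d₁ d₂ →
    1ℤ ℤ.* (a ℤ.* d₁) ℤ.+ (- 1ℤ ℤ.* (b ℤ.* (c ℤ.* d₂)) ℤ.+ 0ℤ) ≡ a ℤ.* d₁ - b ℤ.* c ℤ.* d₂
  expand = ℤ-Solver.solve-∀

-- Principal minors of the tridiagonal pattern

tridiag : ℕ → ℕ → ℤ
tridiag zero          zero          = 1ℤ
tridiag zero          (suc zero)    = 1ℤ
tridiag zero          (suc (suc _)) = 0ℤ
tridiag (suc a)       (suc b)       = tridiag a b
tridiag (suc zero)    zero          = - 1ℤ
tridiag (suc (suc _)) zero          = 0ℤ

tridiag-diagonal : ∀ a → tridiag a a ≡ 1ℤ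
tridiag-diagonal zero    = refl
tridiag-diagonal (suc a) = tridiag-diagonal a

tridiag-super : ∀ a → tridiag a (suc a) ≡ 1ℤ
tridiag-super zero    = refl
tridiag-super (suc a) = tridiag-super a

tridiag-sub : ∀ a → tridiag (suc a) a ≡ - 1ℤ
tridiag-sub zero    = refl
tridiag-sub (suc a) = tridiag-sub a

tridiag-outside : ∀ a b → a ≢ b → suc a ≢ b → a ≢ suc b → tridiag a b ≡ 0ℤ
tridiag-outside zero          zero          a≢b _     _     = contradiction refl a≢b
tridiag-outside zero          (suc zero)    _   sa≢b  _     = contradiction refl sa≢b
tridiag-outside zero          (suc (suc b)) _   _     _     = refl
tridiag-outside (suc zero)    zero          _   _     a≢sb  = contradiction refl a≢sb
tridiag-outside (suc (suc a)) zero          _   _     _     = refl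
tridiag-outside (suc a)       (suc b)       a≢b sa≢b  a≢sb  =
  tridiag-outside a b (a≢b ∘ cong suc) (sa≢b ∘ cong suc) (a≢sb ∘ cong suc)

tridiag-aboveBand : ∀ a c → suc a < c → tridiag a c ≡ 0ℤ
tridiag-aboveBand zero    (suc zero)    (s≤s ())
tridiag-aboveBand zero    (suc (suc c)) _             = refl
tridiag-aboveBand (suc a) (suc c)       (s≤s sa<c)    = tridiag-aboveBand a c sa<c

tridiag-belowBand : ∀ a c → suc a < c → tridiag c a ≡ 0ℤ
tridiag-belowBand zero    (suc zero)    (s≤s ())
tridiag-belowBand zero    (suc (suc c)) _             = refl
tridiag-belowBand (suc a) (suc c)       (s≤s sa<c)    = tridiag-belowBand a c sa<c

F-tridiag : ∀ n (i j : Fin n) → F n i j ≡ tridiag (toℕ i) (toℕ j)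
F-tridiag n i j with toℕ i ℕ.≟ toℕ j | suc (toℕ i) ℕ.≟ toℕ j | toℕ i ℕ.≟ suc (toℕ j)
... | yes i≡j | _        | _        = sym (trans (cong (tridiag (toℕ i)) (sym i≡j)) (tridiag-diagonal (toℕ i)))
... | no _    | yes si≡j | _        = sym (trans (cong (tridiag (toℕ i)) (sym si≡j)) (tridiag-super (toℕ i)))
... | no _    | no _     | yes i≡sj = sym (trans (cong (λ x → tridiag x (toℕ j)) i≡sj) (tridiag-sub (toℕ j)))
... | no i≢j  | no si≢j  | no i≢sj  = sym (tridiag-outside _ _ i≢j si≢j i≢sj)

principalMinor : List ℕ → ℤ
principalMinor []          = 1ℤ
principalMinor (a ∷ [])    = 1ℤ
principalMinor (a ∷ b ∷ r) = principalMinor (b ∷ r) - tridiag a b ℤ.* tridiag b a ℤ.* principalMinor r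

tridiagSub : ∀ {A : Set} → (A → ℕ) → (s : List A) → Matrix (length s)
tridiagSub g s i j = tridiag (g (lookup s i)) (g (lookup s j))

det-tridiagSub : ∀ {A : Set} (g : A → ℕ) s → AllPairs (_<_ on g) s →
  det (tridiagSub g s) ≡ principalMinor (map g s)
det-tridiagSub g []          _ = refl
det-tridiagSub g (a ∷ [])    _ = cong (λ x → 1ℤ ℤ.* (x ℤ.* 1ℤ) ℤ.+ 0ℤ) (tridiag-diagonal (g a))
det-tridiagSub g (a ∷ b ∷ r) ((a<b ∷ _) ∷ (b<r ∷ r↑)) = begin
  det (tridiagSub g (a ∷ b ∷ r))
    ≡⟨ det-tridiagonalStep (tridiagSub g (a ∷ b ∷ r))
         (λ c → tridiag-aboveBand (g a) _ (far c)) (λ c → tridiag-belowBand (g a) _ (far c)) ⟩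
  tridiag (g a) (g a) ℤ.* det (tridiagSub g (b ∷ r)) - ab ℤ.* det (tridiagSub g r)
    ≡⟨ cong₂ (λ x y → x ℤ.* y - ab ℤ.* det (tridiagSub g r)) (tridiag-diagonal (g a))
             (det-tridiagSub g (b ∷ r) (b<r ∷ r↑)) ⟩
  1ℤ ℤ.* principalMinor (map g (b ∷ r)) - ab ℤ.* det (tridiagSub g r)
    ≡⟨ cong₂ (λ x y → x - ab ℤ.* y) (ℤ.*-identityˡ (principalMinor (map g (b ∷ r))))
             (det-tridiagSub g r r↑) ⟩
  principalMinor (map g (a ∷ b ∷ r)) ∎
  where
  open ≡-Reasoning
  ab : ℤ
  ab = tridiag (g a) (g b) ℤ.* tridiag (g b) (g a)
  far : ∀ c → suc (g a) < g (lookup r c)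
  far c = ℕ.≤-<-trans a<b (All.lookup b<r (∈-lookup c))

principalMinor-shift : ∀ t → principalMinor (map suc t) ≡ principalMinor t
principalMinor-shift []          = refl
principalMinor-shift (a ∷ [])    = refl
principalMinor-shift (a ∷ b ∷ r) =
  cong₂ (λ x y → x - tridiag a b ℤ.* tridiag b a ℤ.* y) (principalMinor-shift (b ∷ r)) (principalMinor-shift r)

-- On an increasing list t: the principal minor on t with the index 0 removed, or 0 if 0 ∉ t.
minorWithout0 : List ℕ → ℤ
minorWithout0 []          = 0ℤ
minorWithout0 (zero ∷ t)  = principalMinor t
minorWithout0 (suc _ ∷ _) = 0ℤ

minorWithout0-shift : ∀ t → minorWithout0 (map suc t) ≡ 0ℤ
minorWithout0-shift []      = refl
minorWithout0-shift (_ ∷ _) = refl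

principalMinor-cons0 : ∀ t → principalMinor (0 ∷ map suc t) ≡ principalMinor t ℤ.+ minorWithout0 t
principalMinor-cons0 []          = refl
principalMinor-cons0 (zero ∷ r)  =
  trans (cong₂ (λ x y → x - (- 1ℤ ℤ.* y)) (principalMinor-shift (zero ∷ r)) (principalMinor-shift r))
        (minus-neg (principalMinor (zero ∷ r)) (principalMinor r))
  where
  minus-neg : ∀ a b → a - (- 1ℤ ℤ.* b) ≡ a ℤ.+ b
  minus-neg = ℤ-Solver.solve-∀
principalMinor-cons0 (suc b ∷ r) =
  cong₂ _-_ (principalMinor-shift (suc b ∷ r)) (ℤ.*-zeroˡ (principalMinor (map suc r)))

module ListSum (R : CommutativeSemiring 0ℓ 0ℓ) where
  private
    module R = CommutativeSemiring R
    module ≈ = Setoid R.setoid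
    variable A B : Set
    open Algebra.Properties.CommutativeSemigroup R.+-commutativeSemigroup
      using () renaming (interchange to R-interchange)

  sumOf : (A → R.Carrier) → List A → R.Carrier
  sumOf w = foldr (λ a acc → w a R.+ acc) R.0#

  sumOf-cong : {v w : A → R.Carrier} → ∀ xs → (∀ x → v x R.≈ w x) → sumOf v xs R.≈ sumOf w xs
  sumOf-cong []       e = ≈.refl
  sumOf-cong (x ∷ xs) e = R.+-cong (e x) (sumOf-cong xs e)

  sumOf-congᴬ : {v w : A → R.Carrier} {xs : List A} → All (λ x → v x R.≈ w x) xs → sumOf v xs R.≈ sumOf w xs
  sumOf-congᴬ []       = ≈.refl
  sumOf-congᴬ (e ∷ es) = R.+-cong e (sumOf-congᴬ es)

  sumOf-zero : {w : A → R.Carrier} → ∀ xs → (∀ x → w x R.≈ R.0#) → sumOf w xs R.≈ R.0#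
  sumOf-zero []       e = ≈.refl
  sumOf-zero (x ∷ xs) e = ≈.trans (R.+-cong (e x) (sumOf-zero xs e)) (R.+-identityˡ R.0#)

  sumOf-++ : ∀ (w : A → R.Carrier) xs ys → sumOf w (xs ++ ys) R.≈ sumOf w xs R.+ sumOf w ys
  sumOf-++ w []       ys = ≈.sym (R.+-identityˡ (sumOf w ys))
  sumOf-++ w (x ∷ xs) ys = ≈.trans (R.+-cong ≈.refl (sumOf-++ w xs ys)) (≈.sym (R.+-assoc (w x) _ _))

  sumOf-map : ∀ (w : B → R.Carrier) (f : A → B) xs → sumOf w (map f xs) R.≈ sumOf (w ∘ f) xs
  sumOf-map w f []       = ≈.refl
  sumOf-map w f (x ∷ xs) = R.+-cong ≈.refl (sumOf-map w f xs)

  sumOf-concatMap : ∀ (w : B → R.Carrier) (f : A → List B) xs →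
    sumOf w (concatMap f xs) R.≈ sumOf (sumOf w ∘ f) xs
  sumOf-concatMap w f []       = ≈.refl
  sumOf-concatMap w f (x ∷ xs) =
    ≈.trans (sumOf-++ w (f x) (concatMap f xs)) (R.+-cong ≈.refl (sumOf-concatMap w f xs))

  sumOf-+ : ∀ (v w : A → R.Carrier) xs → sumOf (λ x → v x R.+ w x) xs R.≈ sumOf v xs R.+ sumOf w xs
  sumOf-+ v w []       = ≈.sym (R.+-identityˡ R.0#)
  sumOf-+ v w (x ∷ xs) = ≈.trans (R.+-cong ≈.refl (sumOf-+ v w xs)) (R-interchange (v x) (w x) _ _)

  sumOf-*ˡ : ∀ c (w : A → R.Carrier) xs → sumOf (λ x → c R.* w x) xs R.≈ c R.* sumOf w xs
  sumOf-*ˡ c w []       = ≈.sym (R.zeroʳ c)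
  sumOf-*ˡ c w (x ∷ xs) = ≈.trans (R.+-cong ≈.refl (sumOf-*ˡ c w xs)) (≈.sym (R.distribˡ c (w x) _))

  sumOf-filterᵇ : ∀ (w : A → R.Carrier) (p : A → Bool) xs →
    sumOf w (filterᵇ p xs) R.≈ sumOf (λ x → if p x then w x else R.0#) xs
  sumOf-filterᵇ w p []       = ≈.refl
  sumOf-filterᵇ w p (x ∷ xs) with p x
  ... | true  = R.+-cong ≈.refl (sumOf-filterᵇ w p xs)
  ... | false = ≈.trans (sumOf-filterᵇ w p xs) (≈.sym (R.+-identityˡ _))

-- Sums of principal minors over subsets

ofLength : ℕ → (List ℕ → ℤ) → List ℕ → ℤ
ofLength m h t = if length t ≡ᵇ m then h t else 0ℤ

ofLength-zero : ∀ m h t → h t ≡ 0ℤ → ofLength m h t ≡ 0ℤ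
ofLength-zero m h t ht≡0 with length t ≡ᵇ m
... | true  = ht≡0
... | false = refl

ofLength-shift : ∀ m t → ofLength m principalMinor (map suc t) ≡ ofLength m principalMinor t
ofLength-shift m t = cong₂ (λ l d → if l ≡ᵇ m then d else 0ℤ) (length-map suc t) (principalMinor-shift t)

ofLength-cons0 : ∀ m t → ofLength (suc m) principalMinor (0 ∷ map suc t) ≡
                         ofLength m principalMinor t ℤ.+ ofLength m minorWithout0 t
ofLength-cons0 m t =
  trans (cong (λ l → if l ≡ᵇ m then principalMinor (0 ∷ map suc t) else 0ℤ) (length-map suc t))
        (split (length t ≡ᵇ m))
  where
  split : ∀ b → (if b then principalMinor (0 ∷ map suc t) else 0ℤ) ≡
                (if b then principalMinor t else 0ℤ) ℤ.+ (if b then minorWithout0 t else 0ℤ)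
  split true  = principalMinor-cons0 t
  split false = refl

subsets-increasing : ∀ n → All (AllPairs (_<_ on toℕ)) (subsets n)
subsets-increasing zero    = [] ∷ []
subsets-increasing (suc n) =
  All.++⁺ (All.map⁺ (All.map shift ih))
          (All.map⁺ (All.map (λ inc → All.map⁺ (All.tabulate (λ _ → z<s)) ∷ shift inc) ih))
  where
  ih = subsets-increasing n
  shift : ∀ {s} → AllPairs (_<_ on toℕ) s → AllPairs (_<_ on toℕ) (map suc s)
  shift inc = AllPairs.map⁺ (AllPairs.map ℕ.s<s inc)

module _ where
  open ListSum ℤ.+-*-commutativeSemiring

  sumOverSubsets : ℕ → (List ℕ → ℤ) → ℤ
  sumOverSubsets n w = sumOf (w ∘ map toℕ) (subsets n)

  sumOverSubsets-cong : ∀ n {v w : List ℕ → ℤ} → (∀ t → v t ≡ w t) → sumOverSubsets n v ≡ sumOverSubsets n w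
  sumOverSubsets-cong n e = sumOf-cong (subsets n) (e ∘ map toℕ)

  sumOverSubsets-zero : ∀ n (w : List ℕ → ℤ) → (∀ t → w t ≡ 0ℤ) → sumOverSubsets n w ≡ 0ℤ
  sumOverSubsets-zero n w e = sumOf-zero (subsets n) (e ∘ map toℕ)

  sumOverSubsets-+ : ∀ n (v w : List ℕ → ℤ) →
    sumOverSubsets n (λ t → v t ℤ.+ w t) ≡ sumOverSubsets n v ℤ.+ sumOverSubsets n w
  sumOverSubsets-+ n v w = sumOf-+ (v ∘ map toℕ) (w ∘ map toℕ) (subsets n)

  sumOverSubsets-suc : ∀ n w → sumOverSubsets (suc n) w ≡
    sumOverSubsets n (w ∘ map suc) ℤ.+ sumOverSubsets n (λ t → w (0 ∷ map suc t))
  sumOverSubsets-suc n w =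
    trans (sumOf-++ (w ∘ map toℕ) (map (map suc) ss) (map (λ s → zero ∷ map suc s) ss))
          (cong₂ ℤ._+_ (trans (sumOf-map (w ∘ map toℕ) (map suc) ss)
                              (sumOf-cong ss (λ s → cong w (toℕ-suc s))))
                       (trans (sumOf-map (w ∘ map toℕ) (λ s → zero ∷ map suc s) ss)
                              (sumOf-cong ss (λ s → cong (λ t → w (0 ∷ t)) (toℕ-suc s)))))
    where
    ss = subsets n
    toℕ-suc : ∀ {n} (s : List (Fin n)) → map toℕ (map suc s) ≡ map suc (map toℕ s)
    toℕ-suc s = trans (sym (map-∘ s)) (map-∘ s)

  minorSum : ℕ → ℕ → ℤ
  minorSum n m = sumOverSubsets n (ofLength m principalMinor)

  minorSum₀ : ℕ → ℕ → ℤ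
  minorSum₀ n m = sumOverSubsets n (ofLength m minorWithout0)

  sumPrincipalMinors-F : ∀ n m → sumPrincipalMinors (F n) m ≡ minorSum n m
  sumPrincipalMinors-F n m =
    trans (sumOf-filterᵇ (λ s → det (principalSub (F n) s)) (λ s → length s ≡ᵇ m) (subsets n))
          (sumOf-congᴬ (All.map (λ {s} → term s) (subsets-increasing n)))
    where
    term : ∀ s → AllPairs (_<_ on toℕ) s →
      (if length s ≡ᵇ m then det (principalSub (F n) s) else 0ℤ) ≡ ofLength m principalMinor (map toℕ s)
    term s inc = cong₂ (λ l d → if l ≡ᵇ m then d else 0ℤ) (sym (length-map toℕ s))
      (trans (det-cong (λ i j → F-tridiag n (lookup s i) (lookup s j))) (det-tridiagSub toℕ s inc))

  minorSum-zero : ∀ n → minorSum n 0 ≡ 1ℤ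
  minorSum-zero zero    = refl
  minorSum-zero (suc n) =
    trans (sumOverSubsets-suc n (ofLength 0 principalMinor))
          (cong₂ ℤ._+_ (trans (sumOverSubsets-cong n (ofLength-shift 0)) (minorSum-zero n))
                       (sumOverSubsets-zero n (λ t → ofLength 0 principalMinor (0 ∷ map suc t))
                                            (λ _ → refl)))

  minorSum-suc : ∀ n m →
    minorSum (suc n) (suc m) ≡ minorSum n (suc m) ℤ.+ (minorSum n m ℤ.+ minorSum₀ n m)
  minorSum-suc n m =
    trans (sumOverSubsets-suc n (ofLength (suc m) principalMinor))
          (cong₂ ℤ._+_ (sumOverSubsets-cong n (ofLength-shift (suc m)))
                       (trans (sumOverSubsets-cong n (ofLength-cons0 m))
                              (sumOverSubsets-+ n (ofLength m principalMinor) (ofLength m minorWithout0))))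

  minorSum₀-empty : ∀ m → minorSum₀ 0 m ≡ 0ℤ
  minorSum₀-empty m = cong (ℤ._+ 0ℤ) (ofLength-zero m minorWithout0 [] refl)

  minorSum₀-zero : ∀ n → minorSum₀ n 0 ≡ 0ℤ
  minorSum₀-zero n = sumOverSubsets-zero n (ofLength 0 minorWithout0) λ { [] → refl ; (_ ∷ _) → refl }

  minorSum₀-suc : ∀ n m → minorSum₀ (suc n) (suc m) ≡ minorSum n m
  minorSum₀-suc n m =
    trans (sumOverSubsets-suc n (ofLength (suc m) minorWithout0))
          (trans (cong₂ ℤ._+_ (sumOverSubsets-zero n (ofLength (suc m) minorWithout0 ∘ map suc)
                                 (λ t → ofLength-zero (suc m) minorWithout0 (map suc t) (minorWithout0-shift t)))
                              (sumOverSubsets-cong n (ofLength-shift m)))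
                 (ℤ.+-identityˡ (minorSum n m)))

-- Convolution powers of (f_{j+1})

-- conv g h m = Σ_{i ≤ m} g i * h (m ∸ i)
conv : (ℕ → ℕ) → (ℕ → ℕ) → ℕ → ℕ
conv g h zero    = g 0 * h 0
conv g h (suc m) = g 0 * h (suc m) + conv (g ∘ suc) h m

convPower : ℕ → ℕ → ℕ
convPower zero    zero    = 1
convPower zero    (suc _) = 0
convPower (suc r) m       = conv (fib ∘ suc) (convPower r) m

conv-congʳ : ∀ g {h h′ : ℕ → ℕ} m → (∀ y → y ≤ m → h y ≡ h′ y) → conv g h m ≡ conv g h′ m
conv-congʳ g zero    e = cong (g 0 *_) (e 0 z≤n)
conv-congʳ g (suc m) e =
  cong₂ _+_ (cong (g 0 *_) (e (suc m) ℕ.≤-refl)) (conv-congʳ (g ∘ suc) m (λ y y≤m → e y (ℕ.m≤n⇒m≤1+n y≤m)))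

conv-+ˡ : ∀ (a b h : ℕ → ℕ) m → conv (λ x → a x + b x) h m ≡ conv a h m + conv b h m
conv-+ˡ a b h zero    = ℕ.*-distribʳ-+ (h 0) (a 0) (b 0)
conv-+ˡ a b h (suc m) = begin
  (a 0 + b 0) * h (suc m) + conv (λ x → a (suc x) + b (suc x)) h m
    ≡⟨ cong₂ _+_ (ℕ.*-distribʳ-+ (h (suc m)) (a 0) (b 0)) (conv-+ˡ (a ∘ suc) (b ∘ suc) h m) ⟩
  a 0 * h (suc m) + b 0 * h (suc m) + (conv (a ∘ suc) h m + conv (b ∘ suc) h m)
    ≡⟨ interchange (a 0 * h (suc m)) (b 0 * h (suc m)) _ _ ⟩
  conv a h (suc m) + conv b h (suc m) ∎
  where
  open ≡-Reasoning
  open Algebra.Properties.CommutativeSemigroup ℕ.+-commutativeSemigroup using (interchange)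

-- Uses f_{j+3} = f_{j+2} + f_{j+1} together with f_1 = f_2 = 1.
conv-fib-rec : ∀ h m → conv (fib ∘ suc) h (suc (suc m)) ≡
  h (suc (suc m)) + conv (fib ∘ suc) h (suc m) + conv (fib ∘ suc) h m
conv-fib-rec h m = begin
  1 * h (suc (suc m)) + (1 * h (suc m) + conv (λ x → fib (suc (suc (suc x)))) h m)
    ≡⟨ cong (λ x → 1 * h (suc (suc m)) + (1 * h (suc m) + x)) (conv-+ˡ (λ x → fib (suc (suc x))) (fib ∘ suc) h m) ⟩
  1 * h (suc (suc m)) + (1 * h (suc m) + (conv (λ x → fib (suc (suc x))) h m + conv (fib ∘ suc) h m))
    ≡⟨ regroup (h (suc (suc m))) (h (suc m)) (conv (λ x → fib (suc (suc x))) h m) (conv (fib ∘ suc) h m) ⟩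
  h (suc (suc m)) + conv (fib ∘ suc) h (suc m) + conv (fib ∘ suc) h m ∎
  where
  open ≡-Reasoning
  regroup : ∀ a b c d → 1 * a + (1 * b + (c + d)) ≡ a + (1 * b + c) + d
  regroup = ℕ-Solver.solve-∀

convPower-zero : ∀ r → convPower r 0 ≡ 1
convPower-zero zero    = refl
convPower-zero (suc r) = trans (ℕ.*-identityˡ (convPower r 0)) (convPower-zero r)

convPower-one : ∀ r → convPower r 1 ≡ r
convPower-one zero    = refl
convPower-one (suc r) = begin
  1 * convPower r 1 + 1 * convPower r 0 ≡⟨ cong₂ (λ x y → 1 * x + 1 * y) (convPower-one r) (convPower-zero r) ⟩
  1 * r + 1 * 1                        ≡⟨ ℕ.+-comm (1 * r) 1 ⟩
  suc (1 * r)                          ≡⟨ cong suc (ℕ.*-identityˡ r) ⟩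
  suc r                                ∎
  where open ≡-Reasoning

convPower-rec : ∀ r m → convPower (suc r) (suc (suc m)) ≡
  convPower r (suc (suc m)) + convPower (suc r) (suc m) + convPower (suc r) m
convPower-rec r = conv-fib-rec (convPower r)

fibProduct : ∀ {r} → Vec ℕ r → ℕ
fibProduct v = Vec.foldr _ _*_ 1 (Vec.map (fib ∘ suc) v)

if-*ʳ : ∀ (c : Bool) k a → (if c then k * a else 0) ≡ k * (if c then a else 0)
if-*ʳ true  k a = refl
if-*ʳ false k a = sym (ℕ.*-zeroʳ k)

module _ where
  open ListSum ℕ.+-*-commutativeSemiring

  sumOf-upTo-suc : ∀ (w : ℕ → ℕ) b → sumOf w (upTo (suc b)) ≡ w 0 + sumOf (w ∘ suc) (upTo b)
  sumOf-upTo-suc w b =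
    cong (_+_ (w 0)) (trans (cong (sumOf w) (sym (map-applyUpTo id suc b))) (sumOf-map w suc (upTo b)))

  conv-as-sum : ∀ g (H : ℕ → ℕ → ℕ) → (∀ x y → H (suc x) (suc y) ≡ H x y) → (∀ x → H (suc x) 0 ≡ 0) →
    ∀ m b → m ≤ b → sumOf (λ x → g x * H x m) (upTo (suc b)) ≡ conv g (H 0) m
  conv-as-sum g H shift vanish zero b _ =
    trans (sumOf-upTo-suc (λ x → g x * H x 0) b)
          (trans (cong (_+_ (g 0 * H 0 0))
                       (sumOf-zero (upTo b) (λ x → trans (cong (g (suc x) *_) (vanish x)) (ℕ.*-zeroʳ (g (suc x))))))
                 (ℕ.+-identityʳ (g 0 * H 0 0)))
  conv-as-sum g H shift vanish (suc m) (suc b) (s≤s m≤b) =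
    trans (sumOf-upTo-suc (λ x → g x * H x (suc m)) (suc b))
          (cong (_+_ (g 0 * H 0 (suc m)))
                (trans (sumOf-cong (upTo (suc b)) (λ x → cong (g (suc x) *_) (shift x m)))
                       (conv-as-sum (g ∘ suc) H shift vanish m b m≤b)))

  boxSum : ℕ → ℕ → ℕ → ℕ
  boxSum r b m = sumOf (λ v → if Vec.sum v ≡ᵇ m then fibProduct v else 0) (boxTuples r b)

  boxSum-suc : ∀ r b m → m ≤ b → boxSum (suc r) b m ≡ conv (fib ∘ suc) (boxSum r b) m
  boxSum-suc r b m m≤b = begin
    boxSum (suc r) b m
      ≡⟨ sumOf-concatMap w (λ x → map (x Vec.∷_) (boxTuples r b)) (upTo (suc b)) ⟩
    sumOf (λ x → sumOf w (map (x Vec.∷_) (boxTuples r b))) (upTo (suc b))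
      ≡⟨ sumOf-cong (upTo (suc b)) first-factor ⟩
    sumOf (λ x → fib (suc x) * H x m) (upTo (suc b))
      ≡⟨ conv-as-sum (fib ∘ suc) H (λ _ _ → refl) (λ _ → sumOf-zero (boxTuples r b) (λ _ → refl)) m b m≤b ⟩
    conv (fib ∘ suc) (boxSum r b) m ∎
    where
    open ≡-Reasoning
    w : Vec ℕ (suc r) → ℕ
    w v = if Vec.sum v ≡ᵇ m then fibProduct v else 0
    H : ℕ → ℕ → ℕ
    H x y = sumOf (λ v → if x + Vec.sum v ≡ᵇ y then fibProduct v else 0) (boxTuples r b)
    first-factor : ∀ x → sumOf w (map (x Vec.∷_) (boxTuples r b)) ≡ fib (suc x) * H x m
    first-factor x =
      trans (sumOf-map w (x Vec.∷_) (boxTuples r b))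
            (trans (sumOf-cong (boxTuples r b) (λ v → if-*ʳ (x + Vec.sum v ≡ᵇ m) (fib (suc x)) (fibProduct v)))
                   (sumOf-*ˡ (fib (suc x)) (λ v → if x + Vec.sum v ≡ᵇ m then fibProduct v else 0) (boxTuples r b)))

  boxSum≡convPower : ∀ r b m → m ≤ b → boxSum r b m ≡ convPower r m
  boxSum≡convPower zero    b zero    _   = refl
  boxSum≡convPower zero    b (suc m) _   = refl
  boxSum≡convPower (suc r) b m       m≤b =
    trans (boxSum-suc r b m m≤b)
          (conv-congʳ (fib ∘ suc) m (λ y y≤m → boxSum≡convPower r b y (ℕ.≤-trans y≤m m≤b)))

  convFib≡convPower : ∀ r m → convFib r m ≡ convPower r m
  convFib≡convPower r m =
    trans (sumOf-map id fibProduct (compositions r m))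
          (trans (sumOf-filterᵇ fibProduct (λ v → Vec.sum v ≡ᵇ m) (boxTuples r m))
                 (boxSum≡convPower r m m ℕ.≤-refl))

-- The two recurrences agree

minorSum-vanish : ∀ n m → n < m → minorSum n m ≡ 0ℤ
minorSum-vanish zero    (suc m) _         = refl
minorSum-vanish (suc n) (suc m) (s≤s n<m) =
  trans (minorSum-suc n m)
        (cong₂ ℤ._+_ (minorSum-vanish n (suc m) (ℕ.m≤n⇒m≤1+n n<m))
                     (cong₂ ℤ._+_ (minorSum-vanish n m n<m) (minorSum₀-vanish n m n<m)))
  where
  minorSum₀-vanish : ∀ n m → n < m → minorSum₀ n m ≡ 0ℤ
  minorSum₀-vanish zero    m       _         = minorSum₀-empty m
  minorSum₀-vanish (suc n) (suc m) (s≤s n<m) = trans (minorSum₀-suc n m) (minorSum-vanish n m n<m)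

minorSum-one : ∀ n → minorSum n 1 ≡ + n
minorSum-one zero    = refl
minorSum-one (suc n) = begin
  minorSum (suc n) 1                             ≡⟨ minorSum-suc n 0 ⟩
  minorSum n 1 ℤ.+ (minorSum n 0 ℤ.+ minorSum₀ n 0) ≡⟨ cong₂ ℤ._+_ (minorSum-one n)
                                                     (cong₂ ℤ._+_ (minorSum-zero n) (minorSum₀-zero n)) ⟩
  + n ℤ.+ + 1                                    ≡⟨ ℤ.pos-+ n 1 ⟨
  + (n + 1)                                      ≡⟨ cong +_ (ℕ.+-comm n 1) ⟩
  + suc n                                        ∎
  where open ≡-Reasoning

minorSum-convPower : ∀ m d → minorSum (m + d) m ≡ + convPower (suc d) m
minorSum-convPower zero          d = trans (minorSum-zero d) (cong +_ (sym (convPower-zero (suc d))))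
minorSum-convPower (suc zero)    d = trans (minorSum-one (suc d)) (cong +_ (sym (convPower-one (suc d))))
minorSum-convPower (suc (suc m)) d = begin
  minorSum (suc (suc m) + d) (suc (suc m))
    ≡⟨ minorSum-suc (suc (m + d)) (suc m) ⟩
  minorSum (suc (m + d)) (suc (suc m)) ℤ.+ (minorSum (suc (m + d)) (suc m) ℤ.+ minorSum₀ (suc (m + d)) (suc m))
    ≡⟨ cong₂ ℤ._+_ (corner d) (cong₂ ℤ._+_ (minorSum-convPower (suc m) d)
                                           (trans (minorSum₀-suc (m + d) m) (minorSum-convPower m d))) ⟩
  + convPower d (suc (suc m)) ℤ.+ (+ convPower (suc d) (suc m) ℤ.+ + convPower (suc d) m)
    ≡⟨ cong (ℤ._+_ (+ convPower d (suc (suc m)))) (ℤ.pos-+ (convPower (suc d) (suc m)) (convPower (suc d) m)) ⟨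
  + convPower d (suc (suc m)) ℤ.+ + (convPower (suc d) (suc m) + convPower (suc d) m)
    ≡⟨ ℤ.pos-+ (convPower d (suc (suc m))) (convPower (suc d) (suc m) + convPower (suc d) m) ⟨
  + (convPower d (suc (suc m)) + (convPower (suc d) (suc m) + convPower (suc d) m))
    ≡⟨ cong +_ (trans (convPower-rec d m) (ℕ.+-assoc (convPower d (suc (suc m))) _ _)) ⟨
  + convPower (suc d) (suc (suc m)) ∎
  where
  open ≡-Reasoning
  corner : ∀ d → minorSum (suc (m + d)) (suc (suc m)) ≡ + convPower d (suc (suc m))
  corner zero    = minorSum-vanish (suc (m + 0)) (suc (suc m)) (s≤s (s≤s (ℕ.≤-reflexive (ℕ.+-identityʳ m))))
  corner (suc d) = trans (cong (λ n → minorSum (suc n) (suc (suc m))) (ℕ.+-suc m d))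
                         (minorSum-convPower (suc (suc m)) d)

mainTheorem1 : (n k : ℕ) → 1 ≤ n → k < n →
    sumPrincipalMinors (F n) (n ∸ k) ≡ + convFib (suc k) (n ∸ k)
mainTheorem1 n k _ k<n = begin
  sumPrincipalMinors (F n) (n ∸ k)     ≡⟨ sumPrincipalMinors-F n (n ∸ k) ⟩
  minorSum n (n ∸ k)                   ≡⟨ cong (λ n′ → minorSum n′ (n ∸ k)) (ℕ.m∸n+n≡m (ℕ.<⇒≤ k<n)) ⟨
  minorSum (n ∸ k + k) (n ∸ k)         ≡⟨ minorSum-convPower (n ∸ k) k ⟩
  + convPower (suc k) (n ∸ k)          ≡⟨ cong +_ (convFib≡convPower (suc k) (n ∸ k)) ⟨
  + convFib (suc k) (n ∸ k)            ∎
  where open ≡-Reasoning
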